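{- Let $J$ and $L$ be finite index sets and $\varphi_j$, $\varphi'_l$ fPIL formulas over $P$ and a De Morgan algebra $K$ for every $j\in J$, $l\in L$. Then $$\Big(\biguplus_{j\in J}\varphi_j\Big)\otimes\Big(\biguplus_{l\in L}\varphi'_l\Big)\equiv\,\sim\Big(\biguplus_{j\in J}\varphi_j\uplus\biguplus_{l\in L}\varphi'_l\Big)\otimes\Big(\bigsqcup_{(j,l)\in J\times L}(\varphi_j\sqcap\varphi'_l)\Big).$$
   Context: A De Morgan algebra $(K,\vee,\wedge,0,1,\overline{\cdot})$ is a bounded distributive lattice with bottom $0$, top $1$ and a map $k\mapsto\overline k$ with $\overline{\overline k}=k$ and the De Morgan laws. $P$ is a set of ports; a $K$-fuzzy interaction is $\alpha:P\to K$ with $\alpha(p)\ne0$ for some $p$; $fC(P,K)$ is the set of nonempty (finite) sets of $K$-fuzzy interactions. fPIL formulas: $\varphi::=true\mid p\mid\,!\varphi\mid\varphi\sqcup\varphi$, $\varphi_1\sqcap\varphi_2:=\,!(!\varphi_1\sqcup!\varphi_2)$, with $\|true\|(\alpha)=1$, $\|p\|(\alpha)=\alpha(p)$, $\|!\varphi\|(\alpha)=\overline{\|\varphi\|(\alpha)}$, $\|\varphi_1\sqcup\varphi_2\|(\alpha)=\|\varphi_1\|(\alpha)\vee\|\varphi_2\|(\alpha)$. fPCL formulas: $\zeta::=\varphi\mid\neg\zeta\mid\zeta\oplus\zeta\mid\zeta\uplus\zeta$, $\zeta\otimes\zeta':=\neg(\neg\zeta\oplus\neg\zeta')$, $\sim\zeta:=\zeta\uplus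 true$; for $\gamma\in fC(P,K)$: $\|\varphi\|(\gamma)=\bigwedge_{\alpha\in\gamma}\|\varphi\|(\alpha)$, $\|\neg\zeta\|(\gamma)=\overline{\|\zeta\|(\gamma)}$, $\|\zeta_1\oplus\zeta_2\|(\gamma)=\|\zeta_1\|(\gamma)\vee\|\zeta_2\|(\gamma)$, $\|\zeta_1\uplus\zeta_2\|(\gamma)=\bigvee_{\gamma_1,\gamma_2\in fC(P,K),\,\gamma_1\cup\gamma_2=\gamma}(\|\zeta_1\|(\gamma_1)\wedge\|\zeta_2\|(\gamma_2))$. Indexed operators denote iterated binary operators. $\zeta_1\equiv\zeta_2$ means $\|\zeta_1\|(\gamma)=\|\zeta_2\|(\gamma)$ for all $\gamma\in fC(P,K)$, for an arbitrary De Morgan algebra $K$. -}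

module Defs where

open import Level using (Level; _⊔_) renaming (suc to lsuc)
open import Data.Nat using (ℕ; zero; suc)
open import Data.Fin using (Fin; zero; suc)
open import Data.Bool using (Bool; true; false; not; if_then_else_) renaming (_∧_ to _&&_; _∨_ to _||_)
open import Data.Vec using (Vec; []; _∷_; lookup)
open import Data.List using (List; []; _∷_; map; concatMap; foldr)
open import Data.Product using (Σ; ∃; _,_; proj₁)
open import Relation.Nullary using (¬_)
open import Algebra.Lattice.Bundles using (DistributiveLattice)

record DeMorganAlgebra (c ℓ : Level) : Set (lsuc (c ⊔ ℓ)) where
  field
    distributiveLattice : DistributiveLattice c ℓ
  open DistributiveLattice distributiveLattice public
  field
    𝟘 𝟙        : Carrier
    ∨-identityʳ : ∀ x → (x ∨ 𝟘) ≈ x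
    ∧-identityʳ : ∀ x → (x ∧ 𝟙) ≈ x
    ‾_          : Carrier → Carrier
    ‾-cong      : ∀ {x y} → x ≈ y → (‾ x) ≈ (‾ y)
    ‾-involutive : ∀ x → (‾ (‾ x)) ≈ x
    deMorgan-∨  : ∀ x y → (‾ (x ∨ y)) ≈ ((‾ x) ∧ (‾ y))
    deMorgan-∧  : ∀ x y → (‾ (x ∧ y)) ≈ ((‾ x) ∨ (‾ y))

infixr 6 _⊔ᴵ_
data FPIL (P : Set) : Set where
  true  : FPIL P
  port  : P → FPIL P
  !_    : FPIL P → FPIL P
  _⊔ᴵ_  : FPIL P → FPIL P → FPIL P

_⊓ᴵ_ : ∀ {P} → FPIL P → FPIL P → FPIL P
φ₁ ⊓ᴵ φ₂ = ! ((! φ₁) ⊔ᴵ (! φ₂))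

infixr 5 _⊕_ _⊎ᶜ_ _⊗_
data FPCL (P : Set) : Set where
  pil   : FPIL P → FPCL P
  ¬ᶜ_   : FPCL P → FPCL P
  _⊕_   : FPCL P → FPCL P → FPCL P
  _⊎ᶜ_  : FPCL P → FPCL P → FPCL P

_⊗_ : ∀ {P} → FPCL P → FPCL P → FPCL P
ζ ⊗ ζ' = ¬ᶜ ((¬ᶜ ζ) ⊕ (¬ᶜ ζ'))

∼_ : ∀ {P} → FPCL P → FPCL P
∼ ζ = ζ ⊎ᶜ pil true

⨄ᶜ : ∀ {P} n → (Fin (suc n) → FPCL P) → FPCL P
⨄ᶜ zero    f = f zero
⨄ᶜ (suc n) f = f zero ⊎ᶜ ⨄ᶜ n (λ i → f (suc i))

⨆ᴵ : ∀ {P} n → (Fin (suc n) → FPIL P) → FPIL P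
⨆ᴵ zero    f = f zero
⨆ᴵ (suc n) f = f zero ⊔ᴵ ⨆ᴵ n (λ i → f (suc i))

module Semantics {c ℓ : Level} (P : Set) (K : DeMorganAlgebra c ℓ) where
  open DeMorganAlgebra K

  Interaction : Set (c ⊔ ℓ)
  Interaction = Σ (P → Carrier) λ α → ∃ λ p → ¬ (α p ≈ 𝟘)

  ⟦_⟧ᴵ : FPIL P → Interaction → Carrier
  ⟦ true ⟧ᴵ     α = 𝟙
  ⟦ port p ⟧ᴵ   α = proj₁ α p
  ⟦ ! φ ⟧ᴵ      α = ‾ (⟦ φ ⟧ᴵ α)
  ⟦ φ₁ ⊔ᴵ φ₂ ⟧ᴵ α = ⟦ φ₁ ⟧ᴵ α ∨ ⟦ φ₂ ⟧ᴵ α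

  -- A finite set of interactions is given by a family γ : Fin m → Interaction;
  -- its subsets are described by masks s : Vec Bool m.
  masks : (m : ℕ) → List (Vec Bool m)
  masks zero    = [] ∷ []
  masks (suc m) = concatMap (λ s → (true ∷ s) ∷ (false ∷ s) ∷ []) (masks m)

  nonemptyMask : ∀ {m} → Vec Bool m → Bool
  nonemptyMask []      = false
  nonemptyMask (b ∷ s) = b || nonemptyMask s

  -- s₁ ∪ s₂ = s  (as subsets)
  unionIs : ∀ {m} → Vec Bool m → Vec Bool m → Vec Bool m → Bool
  unionIs []        []        []       = true
  unionIs (a ∷ s₁) (b ∷ s₂) (c ∷ s) = (if (a || b) then c else not c) && unionIs s₁ s₂ s

  ⋁ : List Carrier → Carrier
  ⋁ = foldr _∨_ 𝟘

  -- meet over the members of the subset s of γ (s nonempty where used)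
  ⋀ : ∀ {m} → (Fin m → Carrier) → Vec Bool m → Carrier
  ⋀ {zero}  f []      = 𝟙
  ⋀ {suc m} f (b ∷ s) = (if b then f zero else 𝟙) ∧ ⋀ (λ i → f (suc i)) s

  ⟦_⟧ˢ : FPCL P → ∀ {m} → (Fin m → Interaction) → Vec Bool m → Carrier
  ⟦ pil φ ⟧ˢ    γ s = ⋀ (λ i → ⟦ φ ⟧ᴵ (γ i)) s
  ⟦ ¬ᶜ ζ ⟧ˢ     γ s = ‾ (⟦ ζ ⟧ˢ γ s)
  ⟦ ζ₁ ⊕ ζ₂ ⟧ˢ  γ s = ⟦ ζ₁ ⟧ˢ γ s ∨ ⟦ ζ₂ ⟧ˢ γ s
  ⟦ ζ₁ ⊎ᶜ ζ₂ ⟧ˢ {m} γ s =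
    ⋁ (concatMap (λ s₁ → map (λ s₂ →
         if (nonemptyMask s₁ && nonemptyMask s₂ && unionIs s₁ s₂ s)
         then (⟦ ζ₁ ⟧ˢ γ s₁ ∧ ⟦ ζ₂ ⟧ˢ γ s₂) else 𝟘)
       (masks m)) (masks m))

  allMask : ∀ m → Vec Bool m
  allMask zero    = []
  allMask (suc m) = true ∷ allMask m

  ⟦_⟧ : FPCL P → ∀ {m} → (Fin (suc m) → Interaction) → Carrier
  ⟦ ζ ⟧ {m} γ = ⟦ ζ ⟧ˢ γ (allMask (suc m))

  _≡ᶠ_ : FPCL P → FPCL P → Set (c ⊔ ℓ)
  ζ₁ ≡ᶠ ζ₂ = ∀ m (γ : Fin (suc m) → Interaction) → ⟦ ζ₁ ⟧ γ ≈ ⟦ ζ₂ ⟧ γ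

-- Write X = ⨄ⱼ φⱼ and Y = ⨄ₗ φ'ₗ.  Both sides are ⊗ of two formulas, i.e. meets, and by
-- distributivity ⟦⨆ (φⱼ ⊓ φ'ₗ)⟧ = ⋀_{α ∈ γ} (⟦⨆ φⱼ⟧ α ∧ ⟦⨆ φ'ₗ⟧ α).  Two facts about
-- X do the work.  Every member of a set satisfying X satisfies ⨆ φⱼ; this gives ≤.
-- A nonempty set satisfying X still satisfies X after adding interactions that
-- satisfy ⨆ φⱼ, since each of them joins the block of a φⱼ it satisfies; so the part
-- of γ satisfying X that ∼(X ⊎ Y) provides extends to all of γ, which gives ≥.

module Submission where

open import Defs
open import Level using (Level; _⊔_)
open import Data.Nat using (ℕ; zero; suc)
open import Data.Fin using (Fin; zero; suc)
open import Data.Bool using (Bool; true; false; if_then_else_)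
  renaming (_∧_ to _&&_; _∨_ to _||_)
open import Data.Bool.Properties using (∨-zeroʳ; ∨-idem; ∨-commutativeMonoid)
open import Data.Vec using (Vec; []; _∷_; lookup; zipWith)
open import Data.Vec.Properties using (zipWith-idem)
open import Data.List using (List; []; _∷_; map; concatMap)
open import Data.List.Membership.Propositional using (_∈_)
open import Data.List.Membership.Propositional.Properties
  using (∈-map⁺; ∈-map⁻; ∈-concatMap⁺; ∈-concatMap⁻)
open import Data.List.Relation.Unary.Any as Any using (here; there)
open import Data.Product using (∃₂; _,_)
open import Data.Sum using (_⊎_; inj₁; inj₂)
open import Function using (_∘_)
open import Relation.Binary.PropositionalEquality using (_≡_; refl; cong; cong₂)
open import Algebra.Bundles using (CommutativeMonoid; CommutativeSemigroup)
import Algebra.Properties.CommutativeSemigroup as CommutativeSemigroupProperties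
import Algebra.Lattice.Properties.Lattice as LatticeProperties
open import Relation.Binary.Lattice.Bundles using () renaming (Lattice to OrderLattice)
import Relation.Binary.Lattice.Properties.MeetSemilattice as MeetSemilatticeProperties
import Relation.Binary.Reasoning.PartialOrder as ≤-Reasoning

module FPCLLaws {c ℓ : Level} (P : Set) (K : DeMorganAlgebra c ℓ) where
  open DeMorganAlgebra K hiding (refl; reflexive)
  open Semantics P K

  open OrderLattice (LatticeProperties.∨-∧-orderTheoreticLattice lattice) public
    using (_≤_; poset; antisym; reflexive; x≤x∨y; y≤x∨y; ∨-least; x∧y≤x; x∧y≤y; ∧-greatest;
           meetSemilattice)
    renaming (refl to ≤-refl; trans to ≤-trans)
  open MeetSemilatticeProperties meetSemilattice public using (∧-monotonic)
  open ≤-Reasoning poset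

  ∧-commutativeSemigroup : CommutativeSemigroup c ℓ
  ∧-commutativeSemigroup = record
    { isCommutativeSemigroup = record
      { isSemigroup = LatticeProperties.∧-isSemigroup lattice ; comm = ∧-comm } }

  open CommutativeSemigroupProperties ∧-commutativeSemigroup
    using (interchange; x∙yz≈y∙xz)

  infixr 6 _∪ₘ_
  _∪ₘ_ : ∀ {m} → Vec Bool m → Vec Bool m → Vec Bool m
  _∪ₘ_ = zipWith _||_

  ∪ₘ-idem : ∀ {m} (s : Vec Bool m) → s ∪ₘ s ≡ s
  ∪ₘ-idem = zipWith-idem ∨-idem

  ∪ₘ-allMaskʳ : ∀ {m} (t : Vec Bool m) → t ∪ₘ allMask m ≡ allMask m
  ∪ₘ-allMaskʳ []      = refl
  ∪ₘ-allMaskʳ (b ∷ t) = cong₂ _∷_ (∨-zeroʳ b) (∪ₘ-allMaskʳ t)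

  ∪ₘ-interchange : ∀ {m} (t₁ t₂ u₁ u₂ : Vec Bool m) →
                   (t₁ ∪ₘ u₁) ∪ₘ (t₂ ∪ₘ u₂) ≡ (t₁ ∪ₘ t₂) ∪ₘ (u₁ ∪ₘ u₂)
  ∪ₘ-interchange []        []        []        []        = refl
  ∪ₘ-interchange (a ∷ t₁) (b ∷ t₂) (c' ∷ u₁) (d ∷ u₂) =
    cong₂ _∷_ (BoolProperties.interchange a c' b d) (∪ₘ-interchange t₁ t₂ u₁ u₂)
    where
    module BoolProperties =
      CommutativeSemigroupProperties (CommutativeMonoid.commutativeSemigroup ∨-commutativeMonoid)

  lookup-∪ₘ : ∀ {m} (s t : Vec Bool m) i → lookup (s ∪ₘ t) i ≡ true →
              lookup s i ≡ true ⊎ lookup t i ≡ true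
  lookup-∪ₘ (true  ∷ s) (b ∷ t) zero    _ = inj₁ refl
  lookup-∪ₘ (false ∷ s) (b ∷ t) zero    e = inj₂ e
  lookup-∪ₘ (a     ∷ s) (b ∷ t) (suc i) e = lookup-∪ₘ s t i e

  nonemptyMask-∪ₘˡ : ∀ {m} (s t : Vec Bool m) →
                     nonemptyMask s ≡ true → nonemptyMask (s ∪ₘ t) ≡ true
  nonemptyMask-∪ₘˡ (true  ∷ s) (b     ∷ t) _ = refl
  nonemptyMask-∪ₘˡ (false ∷ s) (true  ∷ t) _ = refl
  nonemptyMask-∪ₘˡ (false ∷ s) (false ∷ t) e = nonemptyMask-∪ₘˡ s t e

  unionIs⇒≡∪ₘ : ∀ {m} (s₁ s₂ s : Vec Bool m) → unionIs s₁ s₂ s ≡ true → s ≡ s₁ ∪ₘ s₂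
  unionIs⇒≡∪ₘ []          []          []          _ = refl
  unionIs⇒≡∪ₘ (true  ∷ s₁) (b     ∷ s₂) (true  ∷ s) e = cong (true ∷_) (unionIs⇒≡∪ₘ s₁ s₂ s e)
  unionIs⇒≡∪ₘ (false ∷ s₁) (true  ∷ s₂) (true  ∷ s) e = cong (true ∷_) (unionIs⇒≡∪ₘ s₁ s₂ s e)
  unionIs⇒≡∪ₘ (false ∷ s₁) (false ∷ s₂) (false ∷ s) e = cong (false ∷_) (unionIs⇒≡∪ₘ s₁ s₂ s e)
  unionIs⇒≡∪ₘ (true  ∷ s₁) (b     ∷ s₂) (false ∷ s) ()
  unionIs⇒≡∪ₘ (false ∷ s₁) (true  ∷ s₂) (false ∷ s) ()
  unionIs⇒≡∪ₘ (false ∷ s₁) (false ∷ s₂) (true  ∷ s) ()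

  unionIs-∪ₘ : ∀ {m} (s₁ s₂ : Vec Bool m) → unionIs s₁ s₂ (s₁ ∪ₘ s₂) ≡ true
  unionIs-∪ₘ []          []          = refl
  unionIs-∪ₘ (true  ∷ s₁) (b     ∷ s₂) = unionIs-∪ₘ s₁ s₂
  unionIs-∪ₘ (false ∷ s₁) (true  ∷ s₂) = unionIs-∪ₘ s₁ s₂
  unionIs-∪ₘ (false ∷ s₁) (false ∷ s₂) = unionIs-∪ₘ s₁ s₂

  ∈-masks : ∀ {m} (s : Vec Bool m) → s ∈ masks m
  ∈-masks []          = here refl
  ∈-masks (true  ∷ s) = ∈-concatMap⁺ _ (Any.map (λ { refl → here refl }) (∈-masks s))
  ∈-masks (false ∷ s) = ∈-concatMap⁺ _ (Any.map (λ { refl → there (here refl) }) (∈-masks s))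

  x≤𝟙 : ∀ x → x ≤ 𝟙
  x≤𝟙 x = sym (∧-identityʳ x)  -- x ≤ y unfolds to x ≈ x ∧ y

  𝟘≤x : ∀ x → 𝟘 ≤ x
  𝟘≤x x = begin
    𝟘      ≤⟨ x≤x∨y 𝟘 x ⟩
    𝟘 ∨ x  ≈⟨ ∨-comm 𝟘 x ⟩
    x ∨ 𝟘  ≈⟨ ∨-identityʳ x ⟩
    x      ∎

  ∧-identityˡ : ∀ x → 𝟙 ∧ x ≈ x
  ∧-identityˡ x = antisym (x∧y≤y 𝟙 x) (∧-greatest (x≤𝟙 x) ≤-refl)

  deMorgan-‾∨‾ : ∀ x y → ‾ (‾ x ∨ ‾ y) ≈ x ∧ y
  deMorgan-‾∨‾ x y = begin-equality
    ‾ (‾ x ∨ ‾ y)       ≈⟨ deMorgan-∨ (‾ x) (‾ y) ⟩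
    ‾ (‾ x) ∧ ‾ (‾ y)   ≈⟨ ∧-cong (‾-involutive x) (‾-involutive y) ⟩
    x ∧ y               ∎

  ⟦⊓ᴵ⟧ᴵ : ∀ φ ψ α → ⟦ φ ⊓ᴵ ψ ⟧ᴵ α ≈ ⟦ φ ⟧ᴵ α ∧ ⟦ ψ ⟧ᴵ α
  ⟦⊓ᴵ⟧ᴵ φ ψ α = deMorgan-‾∨‾ (⟦ φ ⟧ᴵ α) (⟦ ψ ⟧ᴵ α)

  ⟦⨆ᴵ-⊓ᴵˡ⟧ᴵ : ∀ ψ n (φ : Fin (suc n) → FPIL P) α →
              ⟦ ⨆ᴵ n (λ l → ψ ⊓ᴵ φ l) ⟧ᴵ α ≈ ⟦ ψ ⟧ᴵ α ∧ ⟦ ⨆ᴵ n φ ⟧ᴵ α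
  ⟦⨆ᴵ-⊓ᴵˡ⟧ᴵ ψ zero  φ α = ⟦⊓ᴵ⟧ᴵ ψ (φ zero) α
  ⟦⨆ᴵ-⊓ᴵˡ⟧ᴵ ψ (suc n) φ α = begin-equality
    ⟦ ψ ⊓ᴵ φ zero ⟧ᴵ α ∨ ⟦ ⨆ᴵ n (λ l → ψ ⊓ᴵ φ (suc l)) ⟧ᴵ α
      ≈⟨ ∨-cong (⟦⊓ᴵ⟧ᴵ ψ (φ zero) α) (⟦⨆ᴵ-⊓ᴵˡ⟧ᴵ ψ n (φ ∘ suc) α) ⟩
    (⟦ ψ ⟧ᴵ α ∧ ⟦ φ zero ⟧ᴵ α) ∨ (⟦ ψ ⟧ᴵ α ∧ ⟦ ⨆ᴵ n (φ ∘ suc) ⟧ᴵ α)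
      ≈⟨ ∧-distribˡ-∨ _ _ _ ⟨
    ⟦ ψ ⟧ᴵ α ∧ ⟦ ⨆ᴵ (suc n) φ ⟧ᴵ α
      ∎

  ⟦⨆ᴵ⨆ᴵ-⊓ᴵ⟧ᴵ : ∀ a (φ : Fin (suc a) → FPIL P) b (φ' : Fin (suc b) → FPIL P) α →
               ⟦ ⨆ᴵ a (λ j → ⨆ᴵ b (λ l → φ j ⊓ᴵ φ' l)) ⟧ᴵ α ≈ ⟦ ⨆ᴵ a φ ⟧ᴵ α ∧ ⟦ ⨆ᴵ b φ' ⟧ᴵ α
  ⟦⨆ᴵ⨆ᴵ-⊓ᴵ⟧ᴵ zero  φ b φ' α = ⟦⨆ᴵ-⊓ᴵˡ⟧ᴵ (φ zero) b φ' α
  ⟦⨆ᴵ⨆ᴵ-⊓ᴵ⟧ᴵ (suc a) φ b φ' α = begin-equality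
    ⟦ ⨆ᴵ b (λ l → φ zero ⊓ᴵ φ' l) ⟧ᴵ α ∨ ⟦ ⨆ᴵ a (λ j → ⨆ᴵ b (λ l → φ (suc j) ⊓ᴵ φ' l)) ⟧ᴵ α
      ≈⟨ ∨-cong (⟦⨆ᴵ-⊓ᴵˡ⟧ᴵ (φ zero) b φ' α) (⟦⨆ᴵ⨆ᴵ-⊓ᴵ⟧ᴵ a (φ ∘ suc) b φ' α) ⟩
    (⟦ φ zero ⟧ᴵ α ∧ ⟦ ⨆ᴵ b φ' ⟧ᴵ α) ∨ (⟦ ⨆ᴵ a (φ ∘ suc) ⟧ᴵ α ∧ ⟦ ⨆ᴵ b φ' ⟧ᴵ α)
      ≈⟨ ∧-distribʳ-∨ _ _ _ ⟨
    ⟦ ⨆ᴵ (suc a) φ ⟧ᴵ α ∧ ⟦ ⨆ᴵ b φ' ⟧ᴵ α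
      ∎

  ⋀-lowerBound : ∀ {m} (f : Fin m → Carrier) s i → lookup s i ≡ true → ⋀ f s ≤ f i
  ⋀-lowerBound f (true ∷ s) zero    _ = x∧y≤x _ _
  ⋀-lowerBound f (b    ∷ s) (suc i) e = ≤-trans (x∧y≤y _ _) (⋀-lowerBound (f ∘ suc) s i e)

  ⋀-greatest : ∀ {m} (f : Fin m → Carrier) s {x} →
               (∀ i → lookup s i ≡ true → x ≤ f i) → x ≤ ⋀ f s
  ⋀-greatest f []          h = x≤𝟙 _
  ⋀-greatest f (true  ∷ s) h = ∧-greatest (h zero refl) (⋀-greatest (f ∘ suc) s (h ∘ suc))
  ⋀-greatest f (false ∷ s) h = ∧-greatest (x≤𝟙 _) (⋀-greatest (f ∘ suc) s (h ∘ suc))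

  ⋀-mono : ∀ {m} {f g : Fin m → Carrier} s → (∀ i → f i ≤ g i) → ⋀ f s ≤ ⋀ g s
  ⋀-mono {f = f} {g} s f≤g = ⋀-greatest g s λ i e → ≤-trans (⋀-lowerBound f s i e) (f≤g i)

  ⋀-cong : ∀ {m} {f g : Fin m → Carrier} s → (∀ i → f i ≈ g i) → ⋀ f s ≈ ⋀ g s
  ⋀-cong s f≈g = antisym (⋀-mono s (reflexive ∘ f≈g)) (⋀-mono s (reflexive ∘ sym ∘ f≈g))

  ⋀-∧ : ∀ {m} (f g : Fin m → Carrier) s → ⋀ (λ i → f i ∧ g i) s ≈ ⋀ f s ∧ ⋀ g s
  ⋀-∧ f g s = antisym
    (∧-greatest (⋀-mono s (λ i → x∧y≤x _ _)) (⋀-mono s (λ i → x∧y≤y _ _)))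
    (⋀-greatest _ s λ i e → ∧-monotonic (⋀-lowerBound f s i e) (⋀-lowerBound g s i e))

  ⋀-∪ₘ : ∀ {m} (f : Fin m → Carrier) s t → ⋀ f s ∧ ⋀ f t ≤ ⋀ f (s ∪ₘ t)
  ⋀-∪ₘ f s t = ⋀-greatest f (s ∪ₘ t) λ i e → bound (lookup-∪ₘ s t i e)
    where
    bound : ∀ {i} → lookup s i ≡ true ⊎ lookup t i ≡ true → ⋀ f s ∧ ⋀ f t ≤ f i
    bound (inj₁ e) = ≤-trans (x∧y≤x _ _) (⋀-lowerBound f s _ e)
    bound (inj₂ e) = ≤-trans (x∧y≤y _ _) (⋀-lowerBound f t _ e)

  ⋀-false∷ : ∀ {m} (f : Fin (suc m) → Carrier) s → ⋀ f (false ∷ s) ≈ ⋀ (f ∘ suc) s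
  ⋀-false∷ f s = ∧-identityˡ (⋀ (f ∘ suc) s)

  -- x accumulates, for each member of u already passed, the one of f, g chosen for it.
  ⋀-∨-∧-least : ∀ {m} (f g : Fin m → Carrier) u x {y} →
                (∀ u₁ u₂ → u ≡ u₁ ∪ₘ u₂ → x ∧ (⋀ f u₁ ∧ ⋀ g u₂) ≤ y) →
                x ∧ ⋀ (λ i → f i ∨ g i) u ≤ y
  ⋀-∨-∧-least f g [] x {y} h = begin
    x ∧ 𝟙        ≈⟨ ∧-congˡ (∧-identityˡ 𝟙) ⟨
    x ∧ (𝟙 ∧ 𝟙)  ≤⟨ h [] [] refl ⟩
    y            ∎
  ⋀-∨-∧-least f g (false ∷ u) x {y} h = begin
    x ∧ ⋀ (λ i → f i ∨ g i) (false ∷ u)  ≈⟨ ∧-congˡ (⋀-false∷ (λ i → f i ∨ g i) u) ⟩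
    x ∧ ⋀ (λ i → f (suc i) ∨ g (suc i)) u ≤⟨ ⋀-∨-∧-least (f ∘ suc) (g ∘ suc) u x h′ ⟩
    y                                    ∎
    where
    h′ : ∀ u₁ u₂ → u ≡ u₁ ∪ₘ u₂ → x ∧ (⋀ (f ∘ suc) u₁ ∧ ⋀ (g ∘ suc) u₂) ≤ y
    h′ u₁ u₂ e = begin
      x ∧ (⋀ (f ∘ suc) u₁ ∧ ⋀ (g ∘ suc) u₂)
        ≈⟨ ∧-congˡ (∧-cong (⋀-false∷ f u₁) (⋀-false∷ g u₂)) ⟨
      x ∧ (⋀ f (false ∷ u₁) ∧ ⋀ g (false ∷ u₂))
        ≤⟨ h (false ∷ u₁) (false ∷ u₂) (cong (false ∷_) e) ⟩
      y ∎
  ⋀-∨-∧-least f g (true ∷ u) x {y} h = begin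
    x ∧ ((f zero ∨ g zero) ∧ R)              ≈⟨ ∧-assoc x _ R ⟨
    (x ∧ (f zero ∨ g zero)) ∧ R              ≈⟨ ∧-congʳ (∧-distribˡ-∨ x (f zero) (g zero)) ⟩
    ((x ∧ f zero) ∨ (x ∧ g zero)) ∧ R        ≈⟨ ∧-distribʳ-∨ R _ _ ⟩
    ((x ∧ f zero) ∧ R) ∨ ((x ∧ g zero) ∧ R)  ≤⟨ ∨-least (⋀-∨-∧-least (f ∘ suc) (g ∘ suc) u _ hᶠ)
                                                         (⋀-∨-∧-least (f ∘ suc) (g ∘ suc) u _ hᵍ) ⟩
    y                                        ∎
    where
    R : Carrier
    R = ⋀ (λ i → f (suc i) ∨ g (suc i)) u
    hᶠ : ∀ u₁ u₂ → u ≡ u₁ ∪ₘ u₂ → (x ∧ f zero) ∧ (⋀ (f ∘ suc) u₁ ∧ ⋀ (g ∘ suc) u₂) ≤ y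
    hᶠ u₁ u₂ e = begin
      (x ∧ f zero) ∧ (⋀ (f ∘ suc) u₁ ∧ ⋀ (g ∘ suc) u₂)  ≈⟨ ∧-assoc _ _ _ ⟩
      x ∧ (f zero ∧ (⋀ (f ∘ suc) u₁ ∧ ⋀ (g ∘ suc) u₂))  ≈⟨ ∧-congˡ (∧-assoc _ _ _) ⟨
      x ∧ (⋀ f (true ∷ u₁) ∧ ⋀ (g ∘ suc) u₂)           ≈⟨ ∧-congˡ (∧-congˡ (⋀-false∷ g u₂)) ⟨
      x ∧ (⋀ f (true ∷ u₁) ∧ ⋀ g (false ∷ u₂))         ≤⟨ h (true ∷ u₁) (false ∷ u₂) (cong (true ∷_) e) ⟩
      y                                                ∎
    hᵍ : ∀ u₁ u₂ → u ≡ u₁ ∪ₘ u₂ → (x ∧ g zero) ∧ (⋀ (f ∘ suc) u₁ ∧ ⋀ (g ∘ suc) u₂) ≤ y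
    hᵍ u₁ u₂ e = begin
      (x ∧ g zero) ∧ (⋀ (f ∘ suc) u₁ ∧ ⋀ (g ∘ suc) u₂)  ≈⟨ ∧-assoc _ _ _ ⟩
      x ∧ (g zero ∧ (⋀ (f ∘ suc) u₁ ∧ ⋀ (g ∘ suc) u₂))  ≈⟨ ∧-congˡ (x∙yz≈y∙xz _ _ _) ⟩
      x ∧ (⋀ (f ∘ suc) u₁ ∧ ⋀ g (true ∷ u₂))           ≈⟨ ∧-congˡ (∧-congʳ (⋀-false∷ f u₁)) ⟨
      x ∧ (⋀ f (false ∷ u₁) ∧ ⋀ g (true ∷ u₂))         ≤⟨ h (false ∷ u₁) (true ∷ u₂) (cong (true ∷_) e) ⟩
      y                                                ∎

  ⋁-upperBound : ∀ {x} xs → x ∈ xs → x ≤ ⋁ xs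
  ⋁-upperBound (z ∷ zs) (here refl) = x≤x∨y _ _
  ⋁-upperBound (z ∷ zs) (there x∈zs) = ≤-trans (⋁-upperBound zs x∈zs) (y≤x∨y _ _)

  ⋁-∧-least : ∀ xs {d y} → (∀ z → z ∈ xs → z ∧ d ≤ y) → ⋁ xs ∧ d ≤ y
  ⋁-∧-least []       {d} {y} h = ≤-trans (x∧y≤x 𝟘 d) (𝟘≤x y)
  ⋁-∧-least (z ∷ zs) {d} {y} h = begin
    (z ∨ ⋁ zs) ∧ d        ≈⟨ ∧-distribʳ-∨ d z (⋁ zs) ⟩
    z ∧ d ∨ ⋁ zs ∧ d      ≤⟨ ∨-least (h z (here refl)) (⋁-∧-least zs (λ w → h w ∘ there)) ⟩
    y                     ∎

  splittings : ∀ {m} → (Vec Bool m → Vec Bool m → Carrier) → List Carrier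
  splittings {m} T = concatMap (λ s₁ → map (T s₁) (masks m)) (masks m)

  ∈-splittings : ∀ {m} (T : Vec Bool m → Vec Bool m → Carrier) s₁ s₂ → T s₁ s₂ ∈ splittings T
  ∈-splittings T s₁ s₂ =
    ∈-concatMap⁺ _ (Any.map (λ { refl → ∈-map⁺ (T s₁) (∈-masks s₂) }) (∈-masks s₁))

  ∈-splittings⁻ : ∀ {m} (T : Vec Bool m → Vec Bool m → Carrier) {z} →
                  z ∈ splittings T → ∃₂ λ s₁ s₂ → z ≡ T s₁ s₂
  ∈-splittings⁻ T z∈ with Any.satisfied (∈-concatMap⁻ _ {xs = masks _} z∈)
  ... | s₁ , z∈row with ∈-map⁻ (T s₁) z∈row
  ...   | s₂ , _ , z≡ = s₁ , s₂ , z≡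

  -- ⟦ ζ₁ ⊎ᶜ ζ₂ ⟧ˢ γ s is definitionally ⋁ (splittings (splitTerm ζ₁ ζ₂ γ s)).
  splitTerm : FPCL P → FPCL P → ∀ {m} → (Fin m → Interaction) → (s s₁ s₂ : Vec Bool m) → Carrier
  splitTerm ζ₁ ζ₂ γ s s₁ s₂ =
    if nonemptyMask s₁ && nonemptyMask s₂ && unionIs s₁ s₂ s
    then ⟦ ζ₁ ⟧ˢ γ s₁ ∧ ⟦ ζ₂ ⟧ˢ γ s₂ else 𝟘

  ≤-if-true : ∀ {b₁ b₂ b₃} x → b₁ ≡ true → b₂ ≡ true → b₃ ≡ true →
              x ≤ (if b₁ && b₂ && b₃ then x else 𝟘)
  ≤-if-true x refl refl refl = ≤-refl

  if-∧-≤ : ∀ b₁ b₂ b₃ {x d y} → (b₁ ≡ true → b₂ ≡ true → b₃ ≡ true → x ∧ d ≤ y) →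
           (if b₁ && b₂ && b₃ then x else 𝟘) ∧ d ≤ y
  if-∧-≤ true  true  true  h = h refl refl refl
  if-∧-≤ true  true  false h = ≤-trans (x∧y≤x _ _) (𝟘≤x _)
  if-∧-≤ true  false b₃    h = ≤-trans (x∧y≤x _ _) (𝟘≤x _)
  if-∧-≤ false b₂    b₃    h = ≤-trans (x∧y≤x _ _) (𝟘≤x _)

  ⊎ᶜ-upperBound : ∀ ζ₁ ζ₂ {m} (γ : Fin m → Interaction) s₁ s₂ →
                  nonemptyMask s₁ ≡ true → nonemptyMask s₂ ≡ true →
                  ⟦ ζ₁ ⟧ˢ γ s₁ ∧ ⟦ ζ₂ ⟧ˢ γ s₂ ≤ ⟦ ζ₁ ⊎ᶜ ζ₂ ⟧ˢ γ (s₁ ∪ₘ s₂)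
  ⊎ᶜ-upperBound ζ₁ ζ₂ γ s₁ s₂ ne₁ ne₂ = begin
    ⟦ ζ₁ ⟧ˢ γ s₁ ∧ ⟦ ζ₂ ⟧ˢ γ s₂    ≤⟨ ≤-if-true _ ne₁ ne₂ (unionIs-∪ₘ s₁ s₂) ⟩
    T s₁ s₂                        ≤⟨ ⋁-upperBound (splittings T) (∈-splittings T s₁ s₂) ⟩
    ⟦ ζ₁ ⊎ᶜ ζ₂ ⟧ˢ γ (s₁ ∪ₘ s₂)      ∎
    where
    T : Vec Bool _ → Vec Bool _ → Carrier
    T = splitTerm ζ₁ ζ₂ γ (s₁ ∪ₘ s₂)

  ⊎ᶜ-∧-least : ∀ ζ₁ ζ₂ {m} (γ : Fin m → Interaction) s {d y} →
               (∀ s₁ s₂ → nonemptyMask s₁ ≡ true → nonemptyMask s₂ ≡ true → s ≡ s₁ ∪ₘ s₂ →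
                  (⟦ ζ₁ ⟧ˢ γ s₁ ∧ ⟦ ζ₂ ⟧ˢ γ s₂) ∧ d ≤ y) →
               ⟦ ζ₁ ⊎ᶜ ζ₂ ⟧ˢ γ s ∧ d ≤ y
  ⊎ᶜ-∧-least ζ₁ ζ₂ γ s {d} {y} h = ⋁-∧-least (splittings T) λ z z∈ → bound (∈-splittings⁻ T z∈)
    where
    T : Vec Bool _ → Vec Bool _ → Carrier
    T = splitTerm ζ₁ ζ₂ γ s
    bound : ∀ {z} → ∃₂ (λ s₁ s₂ → z ≡ T s₁ s₂) → z ∧ d ≤ y
    bound (s₁ , s₂ , refl) = if-∧-≤ (nonemptyMask s₁) (nonemptyMask s₂) (unionIs s₁ s₂ s)
      λ ne₁ ne₂ u → h s₁ s₂ ne₁ ne₂ (unionIs⇒≡∪ₘ s₁ s₂ s u)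

  ⊎ᶜ-∧-leastˡ : ∀ ζ₁ ζ₂ {m} (γ : Fin m → Interaction) s {d y} →
                (∀ s₁ → nonemptyMask s₁ ≡ true → ⟦ ζ₁ ⟧ˢ γ s₁ ∧ d ≤ y) →
                ⟦ ζ₁ ⊎ᶜ ζ₂ ⟧ˢ γ s ∧ d ≤ y
  ⊎ᶜ-∧-leastˡ ζ₁ ζ₂ γ s h = ⊎ᶜ-∧-least ζ₁ ζ₂ γ s λ s₁ _ ne₁ _ _ →
    ≤-trans (∧-monotonic (x∧y≤x _ _) ≤-refl) (h s₁ ne₁)

  ⊎ᶜ-∧-leastʳ : ∀ ζ₁ ζ₂ {m} (γ : Fin m → Interaction) s {d y} →
                (∀ s₂ → nonemptyMask s₂ ≡ true → ⟦ ζ₂ ⟧ˢ γ s₂ ∧ d ≤ y) →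
                ⟦ ζ₁ ⊎ᶜ ζ₂ ⟧ˢ γ s ∧ d ≤ y
  ⊎ᶜ-∧-leastʳ ζ₁ ζ₂ γ s h = ⊎ᶜ-∧-least ζ₁ ζ₂ γ s λ _ s₂ _ ne₂ _ →
    ≤-trans (∧-monotonic (x∧y≤y _ _) ≤-refl) (h s₂ ne₂)

  ∧-≤-⊎ᶜ : ∀ ζ₁ ζ₂ {m} (γ : Fin m → Interaction) s → nonemptyMask s ≡ true →
           ⟦ ζ₁ ⟧ˢ γ s ∧ ⟦ ζ₂ ⟧ˢ γ s ≤ ⟦ ζ₁ ⊎ᶜ ζ₂ ⟧ˢ γ s
  ∧-≤-⊎ᶜ ζ₁ ζ₂ γ s ne = begin
    ⟦ ζ₁ ⟧ˢ γ s ∧ ⟦ ζ₂ ⟧ˢ γ s    ≤⟨ ⊎ᶜ-upperBound ζ₁ ζ₂ γ s s ne ne ⟩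
    ⟦ ζ₁ ⊎ᶜ ζ₂ ⟧ˢ γ (s ∪ₘ s)     ≡⟨ cong (⟦ ζ₁ ⊎ᶜ ζ₂ ⟧ˢ γ) (∪ₘ-idem s) ⟩
    ⟦ ζ₁ ⊎ᶜ ζ₂ ⟧ˢ γ s            ∎

  ≤-∼ : ∀ ζ {m} (γ : Fin m → Interaction) s → nonemptyMask s ≡ true →
        ⟦ ζ ⟧ˢ γ s ≤ ⟦ ∼ ζ ⟧ˢ γ s
  ≤-∼ ζ γ s ne = ≤-trans (∧-greatest ≤-refl (⋀-greatest (λ _ → 𝟙) s λ _ _ → x≤𝟙 _))
                         (∧-≤-⊎ᶜ ζ (pil true) γ s ne)

  record _Entails_ (ζ : FPCL P) (f : Interaction → Carrier) : Set (c ⊔ ℓ) where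
    constructor entails
    field
      ⟦⟧ˢ≤⋀ : ∀ {m} (γ : Fin m → Interaction) s → ⟦ ζ ⟧ˢ γ s ≤ ⋀ (f ∘ γ) s

  open _Entails_ public

  record _Absorbs_ (ζ : FPCL P) (f : Interaction → Carrier) : Set (c ⊔ ℓ) where
    constructor absorbs
    field
      ⟦⟧ˢ-∧-⋀-≤ : ∀ {m} (γ : Fin m → Interaction) t u → nonemptyMask t ≡ true →
                  ⟦ ζ ⟧ˢ γ t ∧ ⋀ (f ∘ γ) u ≤ ⟦ ζ ⟧ˢ γ (t ∪ₘ u)

  pil-entails : ∀ φ → pil φ Entails ⟦ φ ⟧ᴵ
  pil-entails φ = entails λ γ s → ≤-refl

  pil-absorbs : ∀ φ → pil φ Absorbs ⟦ φ ⟧ᴵ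
  pil-absorbs φ = absorbs λ γ t u _ → ⋀-∪ₘ (⟦ φ ⟧ᴵ ∘ γ) t u

  ⊎ᶜ-entails : ∀ {ζ₁ ζ₂ f g} → ζ₁ Entails f → ζ₂ Entails g →
               (ζ₁ ⊎ᶜ ζ₂) Entails (λ α → f α ∨ g α)
  ⊎ᶜ-entails {ζ₁} {ζ₂} {f} {g} (entails ent₁) (entails ent₂) = entails λ γ s → begin
    ⟦ ζ₁ ⊎ᶜ ζ₂ ⟧ˢ γ s              ≈⟨ ∧-identityʳ _ ⟨
    ⟦ ζ₁ ⊎ᶜ ζ₂ ⟧ˢ γ s ∧ 𝟙          ≤⟨ ⊎ᶜ-∧-least ζ₁ ζ₂ γ s (λ { s₁ s₂ _ _ refl → split γ s₁ s₂ }) ⟩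
    ⋀ (λ i → f (γ i) ∨ g (γ i)) s  ∎
    where
    split : ∀ {m} (γ : Fin m → Interaction) s₁ s₂ →
            (⟦ ζ₁ ⟧ˢ γ s₁ ∧ ⟦ ζ₂ ⟧ˢ γ s₂) ∧ 𝟙 ≤ ⋀ (λ i → f (γ i) ∨ g (γ i)) (s₁ ∪ₘ s₂)
    split γ s₁ s₂ = begin
      (⟦ ζ₁ ⟧ˢ γ s₁ ∧ ⟦ ζ₂ ⟧ˢ γ s₂) ∧ 𝟙  ≤⟨ x∧y≤x _ _ ⟩
      ⟦ ζ₁ ⟧ˢ γ s₁ ∧ ⟦ ζ₂ ⟧ˢ γ s₂        ≤⟨ ∧-monotonic (≤-trans (ent₁ γ s₁) (⋀-mono s₁ λ _ → x≤x∨y _ _))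
                                                       (≤-trans (ent₂ γ s₂) (⋀-mono s₂ λ _ → y≤x∨y _ _)) ⟩
      ⋀ fg s₁ ∧ ⋀ fg s₂                  ≤⟨ ⋀-∪ₘ fg s₁ s₂ ⟩
      ⋀ fg (s₁ ∪ₘ s₂)                    ∎
      where
      fg : Fin _ → Carrier
      fg i = f (γ i) ∨ g (γ i)

  ⊎ᶜ-absorbs : ∀ {ζ₁ ζ₂ f g} → ζ₁ Absorbs f → ζ₂ Absorbs g →
               (ζ₁ ⊎ᶜ ζ₂) Absorbs (λ α → f α ∨ g α)
  ⊎ᶜ-absorbs {ζ₁} {ζ₂} {f} {g} (absorbs abs₁) (absorbs abs₂) = absorbs λ γ t u _ →
    ⊎ᶜ-∧-least ζ₁ ζ₂ γ t λ t₁ t₂ ne₁ ne₂ t≡ →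
      ⋀-∨-∧-least (f ∘ γ) (g ∘ γ) u _ λ u₁ u₂ u≡ → begin
        (⟦ ζ₁ ⟧ˢ γ t₁ ∧ ⟦ ζ₂ ⟧ˢ γ t₂) ∧ (⋀ (f ∘ γ) u₁ ∧ ⋀ (g ∘ γ) u₂)
          ≈⟨ interchange _ _ _ _ ⟩
        (⟦ ζ₁ ⟧ˢ γ t₁ ∧ ⋀ (f ∘ γ) u₁) ∧ (⟦ ζ₂ ⟧ˢ γ t₂ ∧ ⋀ (g ∘ γ) u₂)
          ≤⟨ ∧-monotonic (abs₁ γ t₁ u₁ ne₁) (abs₂ γ t₂ u₂ ne₂) ⟩
        ⟦ ζ₁ ⟧ˢ γ (t₁ ∪ₘ u₁) ∧ ⟦ ζ₂ ⟧ˢ γ (t₂ ∪ₘ u₂)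
          ≤⟨ ⊎ᶜ-upperBound ζ₁ ζ₂ γ _ _ (nonemptyMask-∪ₘˡ t₁ u₁ ne₁) (nonemptyMask-∪ₘˡ t₂ u₂ ne₂) ⟩
        ⟦ ζ₁ ⊎ᶜ ζ₂ ⟧ˢ γ ((t₁ ∪ₘ u₁) ∪ₘ (t₂ ∪ₘ u₂))
          ≡⟨ cong (⟦ ζ₁ ⊎ᶜ ζ₂ ⟧ˢ γ) (∪ₘ-interchange t₁ t₂ u₁ u₂) ⟩
        ⟦ ζ₁ ⊎ᶜ ζ₂ ⟧ˢ γ ((t₁ ∪ₘ t₂) ∪ₘ (u₁ ∪ₘ u₂))
          ≡⟨ cong₂ (λ v w → ⟦ ζ₁ ⊎ᶜ ζ₂ ⟧ˢ γ (v ∪ₘ w)) t≡ u≡ ⟨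
        ⟦ ζ₁ ⊎ᶜ ζ₂ ⟧ˢ γ (t ∪ₘ u)
          ∎

  ⨄ᶜ-pil-entails : ∀ n (φ : Fin (suc n) → FPIL P) → ⨄ᶜ n (pil ∘ φ) Entails ⟦ ⨆ᴵ n φ ⟧ᴵ
  ⨄ᶜ-pil-entails zero    φ = pil-entails (φ zero)
  ⨄ᶜ-pil-entails (suc n) φ =
    ⊎ᶜ-entails (pil-entails (φ zero)) (⨄ᶜ-pil-entails n (φ ∘ suc))

  ⨄ᶜ-pil-absorbs : ∀ n (φ : Fin (suc n) → FPIL P) → ⨄ᶜ n (pil ∘ φ) Absorbs ⟦ ⨆ᴵ n φ ⟧ᴵ
  ⨄ᶜ-pil-absorbs zero    φ = pil-absorbs (φ zero)
  ⨄ᶜ-pil-absorbs (suc n) φ =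
    ⊎ᶜ-absorbs (pil-absorbs (φ zero)) (⨄ᶜ-pil-absorbs n (φ ∘ suc))

  absorbs-allMask : ∀ {ζ f} → ζ Absorbs f → ∀ {m} (γ : Fin m → Interaction) t →
                    nonemptyMask t ≡ true →
                    ⟦ ζ ⟧ˢ γ t ∧ ⋀ (f ∘ γ) (allMask m) ≤ ⟦ ζ ⟧ˢ γ (allMask m)
  absorbs-allMask {ζ} {f} (absorbs abs) {m} γ t ne = begin
    ⟦ ζ ⟧ˢ γ t ∧ ⋀ (f ∘ γ) (allMask m)  ≤⟨ abs γ t (allMask m) ne ⟩
    ⟦ ζ ⟧ˢ γ (t ∪ₘ allMask m)          ≡⟨ cong (⟦ ζ ⟧ˢ γ) (∪ₘ-allMaskʳ t) ⟩
    ⟦ ζ ⟧ˢ γ (allMask m)               ∎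

  ⟦pil-⨆ᴵ⨆ᴵ-⊓ᴵ⟧ˢ : ∀ a (φ : Fin (suc a) → FPIL P) b (φ' : Fin (suc b) → FPIL P)
                   {m} (γ : Fin m → Interaction) s →
                   ⟦ pil (⨆ᴵ a (λ j → ⨆ᴵ b (λ l → φ j ⊓ᴵ φ' l))) ⟧ˢ γ s
                     ≈ ⋀ (⟦ ⨆ᴵ a φ ⟧ᴵ ∘ γ) s ∧ ⋀ (⟦ ⨆ᴵ b φ' ⟧ᴵ ∘ γ) s
  ⟦pil-⨆ᴵ⨆ᴵ-⊓ᴵ⟧ˢ a φ b φ' γ s =
    trans (⋀-cong s (λ i → ⟦⨆ᴵ⨆ᴵ-⊓ᴵ⟧ᴵ a φ b φ' (γ i))) (⋀-∧ (⟦ ⨆ᴵ a φ ⟧ᴵ ∘ γ) (⟦ ⨆ᴵ b φ' ⟧ᴵ ∘ γ) s)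

  ∧-≤-∼⊎ᶜ : ∀ ζ₁ ζ₂ {m} (γ : Fin m → Interaction) s → nonemptyMask s ≡ true →
            ⟦ ζ₁ ⟧ˢ γ s ∧ ⟦ ζ₂ ⟧ˢ γ s ≤ ⟦ ∼ (ζ₁ ⊎ᶜ ζ₂) ⟧ˢ γ s
  ∧-≤-∼⊎ᶜ ζ₁ ζ₂ γ s ne = ≤-trans (∧-≤-⊎ᶜ ζ₁ ζ₂ γ s ne) (≤-∼ (ζ₁ ⊎ᶜ ζ₂) γ s ne)

  ∼⊎ᶜ-∧-≤ˡ : ∀ {ζ₁ f} ζ₂ → ζ₁ Absorbs f → ∀ {m} (γ : Fin m → Interaction) s →
             ⟦ ∼ (ζ₁ ⊎ᶜ ζ₂) ⟧ˢ γ s ∧ ⋀ (f ∘ γ) (allMask m) ≤ ⟦ ζ₁ ⟧ˢ γ (allMask m)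
  ∼⊎ᶜ-∧-≤ˡ {ζ₁} ζ₂ abs γ s =
    ⊎ᶜ-∧-leastˡ (ζ₁ ⊎ᶜ ζ₂) (pil true) γ s λ s₁ _ →
      ⊎ᶜ-∧-leastˡ ζ₁ ζ₂ γ s₁ λ t₁ ne₁ → absorbs-allMask abs γ t₁ ne₁

  ∼⊎ᶜ-∧-≤ʳ : ∀ {ζ₂ g} ζ₁ → ζ₂ Absorbs g → ∀ {m} (γ : Fin m → Interaction) s →
             ⟦ ∼ (ζ₁ ⊎ᶜ ζ₂) ⟧ˢ γ s ∧ ⋀ (g ∘ γ) (allMask m) ≤ ⟦ ζ₂ ⟧ˢ γ (allMask m)
  ∼⊎ᶜ-∧-≤ʳ {ζ₂} ζ₁ abs γ s =
    ⊎ᶜ-∧-leastˡ (ζ₁ ⊎ᶜ ζ₂) (pil true) γ s λ s₁ _ →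
      ⊎ᶜ-∧-leastʳ ζ₁ ζ₂ γ s₁ λ t₂ ne₂ → absorbs-allMask abs γ t₂ ne₂

mainTheorem18 : {c ℓ : Level} (P : Set) (K : DeMorganAlgebra c ℓ)
    (a b : ℕ) (φ : Fin (suc a) → FPIL P) (φ' : Fin (suc b) → FPIL P) →
    Semantics._≡ᶠ_ P K
      ((⨄ᶜ a (λ j → pil (φ j))) ⊗ (⨄ᶜ b (λ l → pil (φ' l))))
      ((∼ ((⨄ᶜ a (λ j → pil (φ j))) ⊎ᶜ (⨄ᶜ b (λ l → pil (φ' l)))))
        ⊗ pil (⨆ᴵ a (λ j → ⨆ᴵ b (λ l → φ j ⊓ᴵ φ' l))))
mainTheorem18 P K a b φ φ' m γ =
  trans (deMorgan-‾∨‾ _ _) (trans (antisym XY≤CD CD≤XY) (sym (deMorgan-‾∨‾ _ _)))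
  where
  open DeMorganAlgebra K using (Carrier; _≈_; _∧_; sym; trans)
  open Semantics P K using (⟦_⟧ᴵ; ⟦_⟧ˢ; ⋀; allMask)
  open FPCLLaws P K

  X Y C D : FPCL P
  X = ⨄ᶜ a (λ j → pil (φ j))
  Y = ⨄ᶜ b (λ l → pil (φ' l))
  C = ∼ (X ⊎ᶜ Y)
  D = pil (⨆ᴵ a (λ j → ⨆ᴵ b (λ l → φ j ⊓ᴵ φ' l)))

  full : Vec Bool (suc m)
  full = allMask (suc m)

  A B : Carrier
  A = ⋀ (⟦ ⨆ᴵ a φ ⟧ᴵ ∘ γ) full
  B = ⋀ (⟦ ⨆ᴵ b φ' ⟧ᴵ ∘ γ) full

  D≈A∧B : ⟦ D ⟧ˢ γ full ≈ A ∧ B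
  D≈A∧B = ⟦pil-⨆ᴵ⨆ᴵ-⊓ᴵ⟧ˢ a φ b φ' γ full

  XY≤CD : ⟦ X ⟧ˢ γ full ∧ ⟦ Y ⟧ˢ γ full ≤ ⟦ C ⟧ˢ γ full ∧ ⟦ D ⟧ˢ γ full
  XY≤CD = ∧-greatest (∧-≤-∼⊎ᶜ X Y γ full refl)
    (≤-trans (∧-monotonic (⟦⟧ˢ≤⋀ (⨄ᶜ-pil-entails a φ) γ full) (⟦⟧ˢ≤⋀ (⨄ᶜ-pil-entails b φ') γ full))
             (reflexive (sym D≈A∧B)))

  CD≤XY : ⟦ C ⟧ˢ γ full ∧ ⟦ D ⟧ˢ γ full ≤ ⟦ X ⟧ˢ γ full ∧ ⟦ Y ⟧ˢ γ full
  CD≤XY = ∧-greatest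
    (≤-trans (∧-monotonic ≤-refl (≤-trans (reflexive D≈A∧B) (x∧y≤x A B)))
             (∼⊎ᶜ-∧-≤ˡ Y (⨄ᶜ-pil-absorbs a φ) γ full))
    (≤-trans (∧-monotonic ≤-refl (≤-trans (reflexive D≈A∧B) (x∧y≤y A B)))
             (∼⊎ᶜ-∧-≤ʳ X (⨄ᶜ-pil-absorbs b φ') γ full))
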